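{- Let $\mathcal{L}$ be a first-order signature and $T$ an $\mathcal{L}$-Henkin theory. The following are equivalent: (1) $T$ is prime; (2) for all $\mathcal{L}$-Henkin sequents $S_1,S_2$, if $S_1\sqcup S_2\in T$ then $S_1\in T$ or $S_2\in T$; (3) for all $\mathcal{L}$-Henkin formulas $\varphi,\psi$, if $\emptyset\vartriangleright\varphi\vee\psi\in T$ then $\emptyset\vartriangleright\varphi\in T$ or $\emptyset\vartriangleright\psi\in T$.
   Context: Signature $\mathcal{L}$: relation and function symbols of finite arity, at least one relation symbol; formulas built with $\neg,\wedge,\vee,\forall,\exists$; $\varphi[x\mapsto t]$ is capture-free substitution. The Henkin expansion $\mathrm{Hen}\,\mathcal{L}=\bigcup_i\mathcal{L}_i$, where $\mathcal{L}_0=\mathcal{L}$ and $\mathcal{L}_{i+1}$ adds to $\mathcal{L}_i$ a new constant $\mathsf{w}(\forall x\,\varphi)$ for each universal $\mathcal{L}_i$-formula $\forall x\,\varphi$ and $\mathsf{w}(\exists x\,\varphi)$ for each existential $\mathcal{L}_i$-formula $\exists x\,\varphi$; its formulas/terms are $\mathcal{L}$-Henkin formulas/terms. An $\mathcal{L}$-Henkin sequent $\Gamma\vartriangleright\Delta$ is a pair of finite sets of $\mathcal{L}$-Henkin formulas; $\varphi,\Gamma$ means $\{\varphi\}\cup\Gamma$. $(\Gamma_1\vartriangleright\Delta_1)\sqcup(\Gamma_2\vartriangleright\Delta_2):=\Gamma_1\cup\Gamma_2\vartriangleright\Delta_1\cup\Delta_2$. The calculus $\mathcal{ST}^H$ ($t$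 ranges over $\mathcal{L}$-Henkin terms): axiom (ID) $\varphi\vartriangleright\varphi$; (WL), (WR) weakening on either side; bidirectional rules, usable top-down and bottom-up (from conclusion to any one premise), premises / conclusion: ($\wedge$L) $\varphi,\psi,\Gamma\vartriangleright\Delta$ / $\varphi\wedge\psi,\Gamma\vartriangleright\Delta$; ($\wedge$R) $\Gamma\vartriangleright\Delta,\varphi$ and $\Gamma\vartriangleright\Delta,\psi$ / $\Gamma\vartriangleright\Delta,\varphi\wedge\psi$; ($\vee$L) $\varphi,\Gamma\vartriangleright\Delta$ and $\psi,\Gamma\vartriangleright\Delta$ / $\varphi\vee\psi,\Gamma\vartriangleright\Delta$; ($\vee$R) $\Gamma\vartriangleright\Delta,\varphi,\psi$ / $\Gamma\vartriangleright\Delta,\varphi\vee\psi$; ($\neg$R) $\varphi,\Gamma\vartriangleright\Delta$ / $\Gamma\vartriangleright\Delta,\neg\varphi$; ($\neg$L) $\Gamma\vartriangleright\Delta,\varphi$ / $\neg\varphi,\Gamma\vartriangleright\Delta$; ($\forall$LW) $\varphi[x\mapsto\mathsf{w}(\forall x\,\varphi)],\Gamma\vartriangleright\Delta$ / $\forall x\,\varphi,\Gamma\vartriangleright\Delta$; ($\forall$RW) $\Gamma\vartriangleright\Delta,\varphi[x\mapsto\mathsf{w}(\forall x\,\varphi)]$ / $\Gamma\vartriangleright\Delta,\forall x\,\varphi$; ($\exists$LW), ($\exists$RW) analogously with $\mathsf{w}(\exists x\,\varphi)$ and $\exists x\,\varphi$. One-directional rules: (UWI) $\varphi[x\mapsto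 t],\Gamma\vartriangleright\Delta$ / $\varphi[x\mapsto\mathsf{w}(\forall x\,\varphi)],\Gamma\vartriangleright\Delta$; (EWI) $\Gamma\vartriangleright\Delta,\varphi[x\mapsto t]$ / $\Gamma\vartriangleright\Delta,\varphi[x\mapsto\mathsf{w}(\exists x\,\varphi)]$; (EWE) $\varphi[x\mapsto\mathsf{w}(\exists x\,\varphi)],\Gamma\vartriangleright\Delta$ / $\varphi[x\mapsto t],\Gamma\vartriangleright\Delta$; (UWE) $\Gamma\vartriangleright\Delta,\varphi[x\mapsto\mathsf{w}(\forall x\,\varphi)]$ / $\Gamma\vartriangleright\Delta,\varphi[x\mapsto t]$. No cut. $X\vdash_{\mathcal{ST}^H}S$: there is a finite derivation of $S$ whose leaves are (ID) instances or members of $X$. An $\mathcal{L}$-Henkin theory is a set $T$ of $\mathcal{L}$-Henkin sequents closed under derivability ($T\vdash_{\mathcal{ST}^H}S$ implies $S\in T$). $T$ is prime if whenever $\Gamma\vartriangleright\Delta\in T$ and $\Gamma\cup\Delta\neq\emptyset$, either $\gamma\vartriangleright\emptyset\in T$ for some $\gamma\in\Gamma$ or $\emptyset\vartriangleright\delta\in T$ for some $\delta\in\Delta$. -}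

module Defs where

open import Data.Nat using (ℕ; zero; suc; pred; _<ᵇ_; _≡ᵇ_)
open import Data.Bool using (if_then_else_)
open import Data.Vec using (Vec; []; _∷_)
open import Data.List using (List; []; _∷_; [_]; _++_)
open import Data.List.Membership.Propositional using (_∈_)
open import Data.List.Relation.Binary.Subset.Propositional using (_⊆_)
open import Data.Product using (_×_; Σ-syntax)
open import Data.Sum using (_⊎_)
open import Relation.Binary.PropositionalEquality using (_≡_)
open import Relation.Nullary using (¬_)

record Signature : Set₁ where
  field
    FunSym   : Set
    RelSym   : Set
    funArity : FunSym → ℕ
    relArity : RelSym → ℕ
    someRel  : RelSym

module _ (L : Signature) where
  open Signature L

  -- L-Henkin terms and formulas (the union of all L_i), de Bruijn indices.
  -- wAll φ is the witness constant w(∀x φ) (φ = body of the universal formula),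
  -- wEx φ is the witness constant w(∃x φ).
  data Term : Set
  data Formula : Set

  data Term where
    var  : ℕ → Term
    fun  : (f : FunSym) → Vec Term (funArity f) → Term
    wAll : Formula → Term
    wEx  : Formula → Term

  data Formula where
    rel  : (R : RelSym) → Vec Term (relArity R) → Formula
    neg  : Formula → Formula
    and  : Formula → Formula → Formula
    or   : Formula → Formula → Formula
    all  : Formula → Formula
    ex   : Formula → Formula

  mutual
    upT : Term → Term
    upT (var n)    = var (suc n)
    upT (fun f ts) = fun f (upTs ts)
    upT (wAll φ)   = wAll φ
    upT (wEx φ)    = wEx φ

    upTs : ∀ {n} → Vec Term n → Vec Term n
    upTs []       = []
    upTs (t ∷ ts) = upT t ∷ upTs ts

  substVar : ℕ → Term → ℕ → Term
  substVar k t n =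
    if n <ᵇ k then var n else (if n ≡ᵇ k then t else var (pred n))

  mutual
    substT : ℕ → Term → Term → Term
    substT k t (var n)    = substVar k t n
    substT k t (fun f ts) = fun f (substTs k t ts)
    substT k t (wAll φ)   = wAll φ
    substT k t (wEx φ)    = wEx φ

    substTs : ∀ {n} → ℕ → Term → Vec Term n → Vec Term n
    substTs k t []       = []
    substTs k t (s ∷ ss) = substT k t s ∷ substTs k t ss

    substF : ℕ → Term → Formula → Formula
    substF k t (rel R ts) = rel R (substTs k t ts)
    substF k t (neg φ)    = neg (substF k t φ)
    substF k t (and φ ψ)  = and (substF k t φ) (substF k t ψ)
    substF k t (or φ ψ)   = or (substF k t φ) (substF k t ψ)
    substF k t (all φ)    = all (substF (suc k) (upT t) φ)
    substF k t (ex φ)     = ex (substF (suc k) (upT t) φ)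

  inst : Formula → Term → Formula
  inst φ t = substF 0 t φ

  -- Henkin sequents: finite sets represented as lists, identified up to
  -- having the same members (see the rule setEq below).
  record Sequent : Set where
    constructor _▷_
    field
      ante : List Formula
      succ : List Formula

  _⊔_ : Sequent → Sequent → Sequent
  (Γ₁ ▷ Δ₁) ⊔ (Γ₂ ▷ Δ₂) = (Γ₁ ++ Γ₂) ▷ (Δ₁ ++ Δ₂)

  _≋_ : List Formula → List Formula → Set
  Γ ≋ Γ' = (Γ ⊆ Γ') × (Γ' ⊆ Γ)

  -- X ⊢ S in the calculus ST^H (no cut)
  data Der (X : Sequent → Set) : Sequent → Set where
    hyp   : ∀ {S} → X S → Der X S
    ax    : ∀ φ → Der X ([ φ ] ▷ [ φ ])
    setEq : ∀ {Γ Γ' Δ Δ'} → Γ ≋ Γ' → Δ ≋ Δ' → Der X (Γ ▷ Δ) → Der X (Γ' ▷ Δ')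
    WL    : ∀ {Γ Δ} φ → Der X (Γ ▷ Δ) → Der X ((φ ∷ Γ) ▷ Δ)
    WR    : ∀ {Γ Δ} φ → Der X (Γ ▷ Δ) → Der X (Γ ▷ (φ ∷ Δ))
    -- bidirectional rules: top-down and bottom-up (⁻ variants)
    andL   : ∀ {Γ Δ φ ψ} → Der X ((φ ∷ ψ ∷ Γ) ▷ Δ) → Der X ((and φ ψ ∷ Γ) ▷ Δ)
    andL⁻  : ∀ {Γ Δ φ ψ} → Der X ((and φ ψ ∷ Γ) ▷ Δ) → Der X ((φ ∷ ψ ∷ Γ) ▷ Δ)
    andR   : ∀ {Γ Δ φ ψ} → Der X (Γ ▷ (φ ∷ Δ)) → Der X (Γ ▷ (ψ ∷ Δ)) → Der X (Γ ▷ (and φ ψ ∷ Δ))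
    andR⁻₁ : ∀ {Γ Δ φ ψ} → Der X (Γ ▷ (and φ ψ ∷ Δ)) → Der X (Γ ▷ (φ ∷ Δ))
    andR⁻₂ : ∀ {Γ Δ φ ψ} → Der X (Γ ▷ (and φ ψ ∷ Δ)) → Der X (Γ ▷ (ψ ∷ Δ))
    orL    : ∀ {Γ Δ φ ψ} → Der X ((φ ∷ Γ) ▷ Δ) → Der X ((ψ ∷ Γ) ▷ Δ) → Der X ((or φ ψ ∷ Γ) ▷ Δ)
    orL⁻₁  : ∀ {Γ Δ φ ψ} → Der X ((or φ ψ ∷ Γ) ▷ Δ) → Der X ((φ ∷ Γ) ▷ Δ)
    orL⁻₂  : ∀ {Γ Δ φ ψ} → Der X ((or φ ψ ∷ Γ) ▷ Δ) → Der X ((ψ ∷ Γ) ▷ Δ)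
    orR    : ∀ {Γ Δ φ ψ} → Der X (Γ ▷ (φ ∷ ψ ∷ Δ)) → Der X (Γ ▷ (or φ ψ ∷ Δ))
    orR⁻   : ∀ {Γ Δ φ ψ} → Der X (Γ ▷ (or φ ψ ∷ Δ)) → Der X (Γ ▷ (φ ∷ ψ ∷ Δ))
    negR   : ∀ {Γ Δ φ} → Der X ((φ ∷ Γ) ▷ Δ) → Der X (Γ ▷ (neg φ ∷ Δ))
    negR⁻  : ∀ {Γ Δ φ} → Der X (Γ ▷ (neg φ ∷ Δ)) → Der X ((φ ∷ Γ) ▷ Δ)
    negL   : ∀ {Γ Δ φ} → Der X (Γ ▷ (φ ∷ Δ)) → Der X ((neg φ ∷ Γ) ▷ Δ)
    negL⁻  : ∀ {Γ Δ φ} → Der X ((neg φ ∷ Γ) ▷ Δ) → Der X (Γ ▷ (φ ∷ Δ))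
    allLW  : ∀ {Γ Δ φ} → Der X ((inst φ (wAll φ) ∷ Γ) ▷ Δ) → Der X ((all φ ∷ Γ) ▷ Δ)
    allLW⁻ : ∀ {Γ Δ φ} → Der X ((all φ ∷ Γ) ▷ Δ) → Der X ((inst φ (wAll φ) ∷ Γ) ▷ Δ)
    allRW  : ∀ {Γ Δ φ} → Der X (Γ ▷ (inst φ (wAll φ) ∷ Δ)) → Der X (Γ ▷ (all φ ∷ Δ))
    allRW⁻ : ∀ {Γ Δ φ} → Der X (Γ ▷ (all φ ∷ Δ)) → Der X (Γ ▷ (inst φ (wAll φ) ∷ Δ))
    exLW   : ∀ {Γ Δ φ} → Der X ((inst φ (wEx φ) ∷ Γ) ▷ Δ) → Der X ((ex φ ∷ Γ) ▷ Δ)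
    exLW⁻  : ∀ {Γ Δ φ} → Der X ((ex φ ∷ Γ) ▷ Δ) → Der X ((inst φ (wEx φ) ∷ Γ) ▷ Δ)
    exRW   : ∀ {Γ Δ φ} → Der X (Γ ▷ (inst φ (wEx φ) ∷ Δ)) → Der X (Γ ▷ (ex φ ∷ Δ))
    exRW⁻  : ∀ {Γ Δ φ} → Der X (Γ ▷ (ex φ ∷ Δ)) → Der X (Γ ▷ (inst φ (wEx φ) ∷ Δ))
    UWI : ∀ {Γ Δ φ} t → Der X ((inst φ t ∷ Γ) ▷ Δ) → Der X ((inst φ (wAll φ) ∷ Γ) ▷ Δ)
    EWI : ∀ {Γ Δ φ} t → Der X (Γ ▷ (inst φ t ∷ Δ)) → Der X (Γ ▷ (inst φ (wEx φ) ∷ Δ))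
    EWE : ∀ {Γ Δ φ} t → Der X ((inst φ (wEx φ) ∷ Γ) ▷ Δ) → Der X ((inst φ t ∷ Γ) ▷ Δ)
    UWE : ∀ {Γ Δ φ} t → Der X (Γ ▷ (inst φ (wAll φ) ∷ Δ)) → Der X (Γ ▷ (inst φ t ∷ Δ))

  IsTheory : (Sequent → Set) → Set
  IsTheory T = ∀ S → Der T S → T S

  IsPrime : (Sequent → Set) → Set
  IsPrime T = ∀ Γ Δ → T (Γ ▷ Δ) → ¬ (Γ ≡ [] × Δ ≡ []) →
    (Σ[ γ ∈ Formula ] (γ ∈ Γ × T ([ γ ] ▷ [])))
    ⊎ (Σ[ δ ∈ Formula ] (δ ∈ Δ × T ([] ▷ [ δ ])))

  SplitsJoins : (Sequent → Set) → Set
  SplitsJoins T = ∀ S₁ S₂ → T (S₁ ⊔ S₂) → T S₁ ⊎ T S₂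

  DisjunctionProperty : (Sequent → Set) → Set
  DisjunctionProperty T = ∀ φ ψ → T ([] ▷ [ or φ ψ ]) → T ([] ▷ [ φ ]) ⊎ T ([] ▷ [ ψ ])

-- Primeness, splitting of joins and the disjunction property are proved
-- equivalent by the cycle prime ⇒ splits joins ⇒ disjunction property ⇒ prime.
-- The first two steps are bookkeeping with weakening and (∨R) read bottom-up.
-- For the last, (¬R) moves the antecedent of Γ ▷ Δ into the succedent as
-- negations; folding that succedent into a single disjunction with (∨R) and
-- unfolding it again with the disjunction property yields one provable
-- formula, which is either a member of Δ or the negation ¬γ of a refutable
-- γ ∈ Γ (by (¬R) read bottom-up).
module Submission where

open import Defs
open import Data.Product using (_×_; _,_; Σ-syntax)
open import Data.Sum as Sum using (_⊎_; inj₁; inj₂)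
open import Data.List using (List; []; _∷_; [_]; _++_; map)
open import Data.List.Membership.Propositional using (_∈_)
open import Data.List.Membership.Propositional.Properties using (∈-++⁻; ∈-map⁻)
open import Data.List.Relation.Unary.Any using (here; there)
open import Data.List.Relation.Binary.Subset.Propositional using (_⊆_)
open import Data.List.Relation.Binary.Subset.Propositional.Properties
  using (⊆-refl; ⊆-reflexive-↭; xs⊆xs++ys)
open import Data.List.Relation.Binary.Permutation.Propositional.Properties using (shift)
open import Function.Base using (id; _∘_)
open import Function.Bundles using (_⇔_; mk⇔)
open import Data.Empty using (⊥-elim)
open import Relation.Binary.PropositionalEquality using (refl)

module _ {A : Set} where

  []⊆ : ∀ {xs : List A} → [] ⊆ xs
  []⊆ ()

  [_]⊆ : ∀ {x : A} {xs} → x ∈ xs → [ x ] ⊆ xs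
  [ x∈xs ]⊆ (here refl) = x∈xs

module _ {L : Signature} {X : Sequent L → Set} where

  weakenˡ-++ : ∀ {Γ Δ} Γ′ → Der L X (Γ ▷ Δ) → Der L X ((Γ′ ++ Γ) ▷ Δ)
  weakenˡ-++ []       d = d
  weakenˡ-++ (φ ∷ Γ′) d = WL φ (weakenˡ-++ Γ′ d)

  weakenʳ-++ : ∀ {Γ Δ} Δ′ → Der L X (Γ ▷ Δ) → Der L X (Γ ▷ (Δ′ ++ Δ))
  weakenʳ-++ []       d = d
  weakenʳ-++ (φ ∷ Δ′) d = WR φ (weakenʳ-++ Δ′ d)

  ++-absorbs-⊆ : ∀ {A B : List (Formula L)} → A ⊆ B → _≋_ L (B ++ A) B
  ++-absorbs-⊆ {A} {B} A⊆B = (λ x∈ → Sum.[ id , A⊆B ] (∈-++⁻ B x∈)) , xs⊆xs++ys B A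

  weaken : ∀ {Γ Δ Γ′ Δ′} → Γ ⊆ Γ′ → Δ ⊆ Δ′ → Der L X (Γ ▷ Δ) → Der L X (Γ′ ▷ Δ′)
  weaken {Γ′ = Γ′} {Δ′} Γ⊆Γ′ Δ⊆Δ′ d =
    setEq (++-absorbs-⊆ Γ⊆Γ′) (++-absorbs-⊆ Δ⊆Δ′) (weakenʳ-++ Δ′ (weakenˡ-++ Γ′ d))

  negateAntecedent : ∀ Γ {Δ} → Der L X (Γ ▷ Δ) → Der L X ([] ▷ (map (neg {L}) Γ ++ Δ))
  negateAntecedent []      d = d
  negateAntecedent (γ ∷ Γ) d =
    weaken ⊆-refl (⊆-reflexive-↭ (shift (neg γ) (map neg Γ) _))
      (negateAntecedent Γ (negR d))

module TheoryProperties {L : Signature} {T : Sequent L → Set} (closed : IsTheory L T) where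

  private
    F : Set
    F = Formula L

  AntecedentWitness : List F → Set
  AntecedentWitness Γ = Σ[ γ ∈ F ] (γ ∈ Γ × T ([ γ ] ▷ []))

  SuccedentWitness : List F → Set
  SuccedentWitness Δ = Σ[ δ ∈ F ] (δ ∈ Δ × T ([] ▷ [ δ ]))

  Witness : List F → List F → Set
  Witness Γ Δ = AntecedentWitness Γ ⊎ SuccedentWitness Δ

  -- IsPrime without its side condition Γ ∪ Δ ≠ ∅; the extra alternative
  -- T (∅ ▷ ∅) is harmless because an inconsistent theory refutes everything.
  WeaklyPrime : Set
  WeaklyPrime = ∀ Γ Δ → T (Γ ▷ Δ) → T ([] ▷ []) ⊎ Witness Γ Δ

  weakenᵀ : ∀ {Γ Δ Γ′ Δ′} → Γ ⊆ Γ′ → Δ ⊆ Δ′ → T (Γ ▷ Δ) → T (Γ′ ▷ Δ′)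
  weakenᵀ Γ⊆Γ′ Δ⊆Δ′ t = closed _ (weaken Γ⊆Γ′ Δ⊆Δ′ (hyp t))

  witness⇒theorem : ∀ {Γ Δ} → Witness Γ Δ → T (Γ ▷ Δ)
  witness⇒theorem (inj₁ (_ , γ∈Γ , t)) = weakenᵀ [ γ∈Γ ]⊆ []⊆ t
  witness⇒theorem (inj₂ (_ , δ∈Δ , t)) = weakenᵀ []⊆ [ δ∈Δ ]⊆ t

  witness-++⁻ : ∀ Γ₁ {Γ₂} Δ₁ {Δ₂} → Witness (Γ₁ ++ Γ₂) (Δ₁ ++ Δ₂) → Witness Γ₁ Δ₁ ⊎ Witness Γ₂ Δ₂
  witness-++⁻ Γ₁ Δ₁ (inj₁ (γ , γ∈Γ , t)) =
    Sum.map (λ γ∈Γ₁ → inj₁ (γ , γ∈Γ₁ , t)) (λ γ∈Γ₂ → inj₁ (γ , γ∈Γ₂ , t)) (∈-++⁻ Γ₁ γ∈Γ)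
  witness-++⁻ Γ₁ Δ₁ (inj₂ (δ , δ∈Δ , t)) =
    Sum.map (λ δ∈Δ₁ → inj₂ (δ , δ∈Δ₁ , t)) (λ δ∈Δ₂ → inj₂ (δ , δ∈Δ₂ , t)) (∈-++⁻ Δ₁ δ∈Δ)

  negatedWitness : ∀ Γ {Δ} → SuccedentWitness (map (neg {L}) Γ ++ Δ) → Witness Γ Δ
  negatedWitness Γ (δ , δ∈ , t) with ∈-++⁻ (map neg Γ) δ∈
  ... | inj₂ δ∈Δ = inj₂ (δ , δ∈Δ , t)
  ... | inj₁ δ∈¬Γ with ∈-map⁻ neg δ∈¬Γ
  ...   | γ , γ∈Γ , refl = inj₁ (γ , γ∈Γ , closed _ (negR⁻ (hyp t)))

  prime⇒weaklyPrime : IsPrime L T → WeaklyPrime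
  prime⇒weaklyPrime prime []      []      t = inj₁ t
  prime⇒weaklyPrime prime (γ ∷ Γ) Δ       t = inj₂ (prime (γ ∷ Γ) Δ t λ { (() , _) })
  prime⇒weaklyPrime prime []      (δ ∷ Δ) t = inj₂ (prime [] (δ ∷ Δ) t λ { (_ , ()) })

  weaklyPrime⇒prime : WeaklyPrime → IsPrime L T
  weaklyPrime⇒prime weak Γ Δ t nonEmpty with weak Γ Δ t
  ... | inj₂ w = w
  ... | inj₁ inconsistent with Γ | Δ
  ...   | γ ∷ _ | _     = inj₁ (γ , here refl , weakenᵀ []⊆ []⊆ inconsistent)
  ...   | []    | δ ∷ _ = inj₂ (δ , here refl , weakenᵀ []⊆ []⊆ inconsistent)
  ...   | []    | []    = ⊥-elim (nonEmpty (refl , refl))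

  prime⇒splitsJoins : IsPrime L T → SplitsJoins L T
  prime⇒splitsJoins prime (Γ₁ ▷ Δ₁) (Γ₂ ▷ Δ₂) t with prime⇒weaklyPrime prime _ _ t
  ... | inj₁ inconsistent = inj₁ (weakenᵀ []⊆ []⊆ inconsistent)
  ... | inj₂ w            = Sum.map witness⇒theorem witness⇒theorem (witness-++⁻ Γ₁ Δ₁ w)

  splitsJoins⇒disjunctionProperty : SplitsJoins L T → DisjunctionProperty L T
  splitsJoins⇒disjunctionProperty splits φ ψ t =
    splits ([] ▷ [ φ ]) ([] ▷ [ ψ ]) (closed _ (orR⁻ (hyp t)))

  provedDisjunct : DisjunctionProperty L T → ∀ φ Δ → T ([] ▷ (φ ∷ Δ)) → SuccedentWitness (φ ∷ Δ)
  provedDisjunct dp φ []      t = φ , here refl , t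
  provedDisjunct dp φ (ψ ∷ Δ) t with provedDisjunct dp (or φ ψ) Δ (closed _ (orR (hyp t)))
  ... | δ , there δ∈Δ , tδ = δ , there (there δ∈Δ) , tδ
  ... | _ , here refl , tφ∨ψ =
    Sum.[ (λ tφ → φ , here refl , tφ) , (λ tψ → ψ , there (here refl) , tψ) ] (dp φ ψ tφ∨ψ)

  succedentWitness : DisjunctionProperty L T → ∀ {Δ} → T ([] ▷ Δ) → T ([] ▷ []) ⊎ SuccedentWitness Δ
  succedentWitness dp {[]}    inconsistent = inj₁ inconsistent
  succedentWitness dp {φ ∷ Δ} t            = inj₂ (provedDisjunct dp φ Δ t)

  disjunctionProperty⇒prime : DisjunctionProperty L T → IsPrime L T
  disjunctionProperty⇒prime dp = weaklyPrime⇒prime λ Γ Δ t →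
    Sum.map₂ (negatedWitness Γ) (succedentWitness dp (closed _ (negateAntecedent Γ (hyp t))))

mainTheorem3 : (L : Signature) (T : Sequent L → Set) → IsTheory L T →
    (IsPrime L T ⇔ SplitsJoins L T) × (IsPrime L T ⇔ DisjunctionProperty L T)
mainTheorem3 L T closed =
  mk⇔ prime⇒splitsJoins (disjunctionProperty⇒prime ∘ splitsJoins⇒disjunctionProperty) ,
  mk⇔ (splitsJoins⇒disjunctionProperty ∘ prime⇒splitsJoins) disjunctionProperty⇒prime
  where open TheoryProperties closed
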